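{- Let $G$ be a finite group with a normal subgroup $N = \{1,z\}$ of order $2$, and let $S \subseteq G$ be a sum set. Put $Sz = \{sz : s \in S\}$. If $S$ is type 1 with respect to $N$, then $Sz$ is also a sum set which is type 1 with respect to $N$, and $Sz \cap S = \varnothing$. If $S$ is type 2 with respect to $N$, then $Sz$ is also a sum set which is type 2 with respect to $N$, and $S$ and $Sz$ differ in precisely one element, i.e. $|S \setminus Sz| = |Sz \setminus S| = 1$.
   Context: For $a \in G$, the number of ways to write $a$ as a product in $S$ is the number of ordered pairs $(x,y)\in S\times S$ with $xy=a$. $S$ is a $(|G|,|S|,\mu)$ sum set if every nonidentity element of $G$ is a product in $S$ in exactly $\mu$ ways. For a normal subgroup $N$ of order $2$: $S$ is type 1 with respect to $N$ if $S \cap N = \varnothing$ and $S$ meets each other coset of $N$ in $0$ or $1$ elements; $S$ is type 2 with respect to $N$ if $|S\cap N| = 1$ and $S$ meets each other coset of $N$ in $0$ or $2$ elements. -}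

module Defs where

open import Data.Nat using (ℕ; _≤_)
open import Data.Bool using (Bool; true; false; _∧_; if_then_else_)
open import Data.Bool.ListAction using (any)
open import Data.Nat.ListAction using (sum)
open import Data.Fin using (Fin; _≟_)
open import Data.Fin.Subset using (Subset; ⁅_⁆; _∪_; _∩_; _∉_; ∣_∣)
open import Data.List using (List; map; allFin)
open import Data.Vec using (lookup; tabulate)
open import Data.Product using (∃)
open import Data.Sum using (_⊎_)
open import Relation.Nullary.Decidable using (⌊_⌋)
open import Relation.Binary.PropositionalEquality using (_≡_)

-- A finite group is represented with carrier Fin n (every finite group is
-- isomorphic to one of this form); the group axioms are imposed in the
-- statement via the library's IsGroup with propositional equality.

module _ {n : ℕ} (_·_ : Fin n → Fin n → Fin n) (e : Fin n) where

  reps : Subset n → Fin n → ℕ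
  reps S a = sum (map (λ x → sum (map (λ y →
               if lookup S x ∧ lookup S y ∧ ⌊ (x · y) ≟ a ⌋ then 1 else 0)
               (allFin n))) (allFin n))

  IsSumSetWith : Subset n → ℕ → Set
  IsSumSetWith S μ = ∀ a → a ∉ ⁅ e ⁆ → reps S a ≡ μ

  IsSumSet : Subset n → Set
  IsSumSet S = ∃ λ μ → IsSumSetWith S μ

  rightTranslate : Subset n → Fin n → Subset n
  rightTranslate S z = tabulate (λ g → any (λ s → lookup S s ∧ ⌊ (s · z) ≟ g ⌋) (allFin n))

  subN : Fin n → Subset n
  subN z = ⁅ e ⁆ ∪ ⁅ z ⁆

  cosetN : Fin n → Fin n → Subset n
  cosetN z g = ⁅ g · e ⁆ ∪ ⁅ g · z ⁆

  Type1 : Fin n → Subset n → Set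
  Type1 z S = (∣ S ∩ subN z ∣ ≡ 0)
            Data.Product.× (∀ g → g ∉ subN z → ∣ S ∩ cosetN z g ∣ ≤ 1)

  Type2 : Fin n → Subset n → Set
  Type2 z S = (∣ S ∩ subN z ∣ ≡ 1)
            Data.Product.× (∀ g → g ∉ subN z → (∣ S ∩ cosetN z g ∣ ≡ 0) ⊎ (∣ S ∩ cosetN z g ∣ ≡ 2))

module Submission where

-- Normality of N = {e, z} forces z to be central, so x ↦ x z is an involution with
-- (x z)(y z) = x y.  Reindexing by it shows that S z has the same representation
-- counts as S, and, since N and each of its cosets is an orbit {x, x z}, that
-- S z meets each of them as often as S does.  For type 1 no orbit lies in S, hence
-- S z ∩ S = ∅; for type 2 every orbit outside N lies in S or misses it, so S and S z
-- can only differ on N, of which S contains exactly one element.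

open import Defs
open import Algebra.Bundles using (Group)
open import Algebra.Definitions using (Involutive)
open import Algebra.Structures using (IsGroup)
open import Data.Bool using (Bool; true; false; _∧_; _∨_; not; if_then_else_; T)
open import Data.Bool.ListAction using (any)
open import Data.Bool.Properties using (∧-identityʳ; ∧-zeroʳ; ∨-zeroʳ; ¬-not; ∧-comm; ∧-inverseʳ; ∨-comm; T-∧)
open import Data.Empty using (⊥-elim)
open import Data.Fin using (Fin; zero; suc; _≟_; punchIn; punchOut)
open import Data.Fin.Permutation using (permutation)
open import Data.Fin.Properties using (punchIn-injective; punchInᵢ≢i; punchIn-punchOut)
open import Data.Fin.Subset using (Subset; ⁅_⁆; _∪_; _∩_; _─_; _∈_; _∉_; ∣_∣; Empty)
open import Data.Fin.Subset.Properties using (x∈⁅x⁆; x≢y⇒x∉⁅y⁆; x∈p∪q⁻; x∈⁅y⁆⇒x≡y; _∈?_)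
open import Data.List using (map; allFin; tabulate)
open import Data.List.Membership.Propositional using (lose)
open import Data.List.Membership.Propositional.Properties using (∈-allFin)
open import Data.List.Properties using (map-tabulate)
open import Data.List.Relation.Unary.Any using (satisfied)
open import Data.List.Relation.Unary.Any.Properties using (any⁺; any⁻)
open import Data.Nat using (ℕ; zero; suc; _+_; _≤_; z≤n; s≤s)
open import Data.Nat.ListAction using (sum)
open import Data.Nat.Properties using (+-0-commutativeMonoid; +-identityʳ; +-comm)
open import Data.Product using (_×_; _,_)
open import Data.Sum using (_⊎_; inj₁; inj₂; [_,_]′)
import Data.Sum as Sum
open import Data.Unit using (tt)
open import Data.Vec using (_∷_; []; lookup)
open import Data.Vec.Functional using (removeAt)
open import Data.Vec.Properties using (lookup-zipWith; lookup∘tabulate; []=⇒lookup; lookup⇒[]=)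
open import Function using (id; _∘_; Equivalence; mk⇔)
open import Relation.Nullary using (¬_; yes; no; contradiction)
open import Relation.Nullary.Decidable using (⌊_⌋; does; dec-true; dec-false; does-⇔; toWitness; fromWitness)
open import Relation.Binary.PropositionalEquality

open import Algebra.Properties.CommutativeMonoid.Sum +-0-commutativeMonoid
  using (sum-cong-≗; sum-replicate-zero; sum-permute; sum-remove)
  renaming (sum to ∑)

open ≡-Reasoning

-- Stated with if_then_else_ so that the summand of reps is definitionally an indicator.
indicator : Bool → ℕ
indicator b = if b then 1 else 0

sum-tabulate : ∀ {n} (f : Fin n → ℕ) → sum (tabulate f) ≡ ∑ f
sum-tabulate {zero}  f = refl
sum-tabulate {suc n} f = cong (f zero +_) (sum-tabulate (f ∘ suc))

sum-map-allFin : ∀ {n} (f : Fin n → ℕ) → sum (map f (allFin n)) ≡ ∑ f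
sum-map-allFin f = trans (cong sum (map-tabulate id f)) (sum-tabulate f)

∑-∘-involutive : ∀ {n} (f : Fin n → ℕ) {σ : Fin n → Fin n} → Involutive _≡_ σ → ∑ (f ∘ σ) ≡ ∑ f
∑-∘-involutive f {σ} inv = sym (sum-permute f (permutation σ σ inv inv))

∑-supported-at : ∀ {n} (f : Fin n → ℕ) a → (∀ x → x ≢ a → f x ≡ 0) → ∑ f ≡ f a
∑-supported-at {suc n} f a f≡0 = begin
  ∑ f                     ≡⟨ sum-remove {i = a} f ⟩
  f a + ∑ (removeAt f a)  ≡⟨ cong (f a +_) (sum-cong-≗ {n} (λ x → f≡0 _ (punchInᵢ≢i a x))) ⟩
  f a + ∑ {n} (λ _ → 0)   ≡⟨ cong (f a +_) (sum-replicate-zero n) ⟩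
  f a + 0                 ≡⟨ +-identityʳ (f a) ⟩
  f a                     ∎

∑-supported-at-pair : ∀ {n} (f : Fin n → ℕ) {a b} → a ≢ b →
                      (∀ x → x ≢ a → x ≢ b → f x ≡ 0) → ∑ f ≡ f a + f b
∑-supported-at-pair {suc n} f {a} {b} a≢b f≡0 = begin
  ∑ f                     ≡⟨ sum-remove {i = a} f ⟩
  f a + ∑ (removeAt f a)  ≡⟨ cong (f a +_) (∑-supported-at (removeAt f a) b′ removeAt≡0) ⟩
  f a + f (punchIn a b′)  ≡⟨ cong (λ c → f a + f c) (punchIn-punchOut a≢b) ⟩
  f a + f b               ∎
  where
  b′ = punchOut a≢b
  removeAt≡0 : ∀ x → x ≢ b′ → f (punchIn a x) ≡ 0
  removeAt≡0 x x≢b′ = f≡0 _ (punchInᵢ≢i a x) λ eq →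
    x≢b′ (punchIn-injective a x b′ (trans eq (sym (punchIn-punchOut a≢b))))

∣p∣≡∑indicator : ∀ {n} (p : Subset n) → ∣ p ∣ ≡ ∑ (indicator ∘ lookup p)
∣p∣≡∑indicator []          = refl
∣p∣≡∑indicator (true ∷ p)  = cong suc (∣p∣≡∑indicator p)
∣p∣≡∑indicator (false ∷ p) = ∣p∣≡∑indicator p

∣∣-∘-involutive : ∀ {n} {σ : Fin n → Fin n} → Involutive _≡_ σ → (p q : Subset n) →
                  (∀ x → lookup q x ≡ lookup p (σ x)) → ∣ q ∣ ≡ ∣ p ∣
∣∣-∘-involutive {n} {σ} inv p q q≗p∘σ = begin
  ∣ q ∣                         ≡⟨ ∣p∣≡∑indicator q ⟩
  ∑ (indicator ∘ lookup q)      ≡⟨ sum-cong-≗ {n} (cong indicator ∘ q≗p∘σ) ⟩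
  ∑ (indicator ∘ lookup p ∘ σ)  ≡⟨ ∑-∘-involutive (indicator ∘ lookup p) inv ⟩
  ∑ (indicator ∘ lookup p)      ≡⟨ ∣p∣≡∑indicator p ⟨
  ∣ p ∣                         ∎

lookup-⁅⁆ : ∀ {n} (y x : Fin n) → lookup ⁅ y ⁆ x ≡ does (x ≟ y)
lookup-⁅⁆ y x with x ≟ y
... | yes refl = []=⇒lookup (x∈⁅x⁆ x)
... | no x≢y   = ¬-not (x≢y⇒x∉⁅y⁆ x≢y ∘ lookup⇒[]= x ⁅ y ⁆)

lookup-─ : ∀ {n} (p q : Subset n) x → lookup (p ─ q) x ≡ lookup p x ∧ not (lookup q x)
lookup-─ (s ∷ p) (true  ∷ q) zero    = sym (∧-zeroʳ s)
lookup-─ (s ∷ p) (false ∷ q) zero    = sym (∧-identityʳ s)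
lookup-─ (s ∷ p) (t ∷ q)     (suc x) = lookup-─ p q x

lookup-⁅a⁆∪⁅b⁆ : ∀ {n} (a b x : Fin n) → lookup (⁅ a ⁆ ∪ ⁅ b ⁆) x ≡ does (x ≟ a) ∨ does (x ≟ b)
lookup-⁅a⁆∪⁅b⁆ a b x = trans (lookup-zipWith _∨_ x ⁅ a ⁆ ⁅ b ⁆) (cong₂ _∨_ (lookup-⁅⁆ a x) (lookup-⁅⁆ b x))

lookup-∩⁅a⁆∪⁅b⁆ : ∀ {n} (p : Subset n) a b x →
                  lookup (p ∩ (⁅ a ⁆ ∪ ⁅ b ⁆)) x ≡ lookup p x ∧ (does (x ≟ a) ∨ does (x ≟ b))
lookup-∩⁅a⁆∪⁅b⁆ p a b x =
  trans (lookup-zipWith _∧_ x p _) (cong (lookup p x ∧_) (lookup-⁅a⁆∪⁅b⁆ a b x))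

∣p∩⁅a⁆∪⁅b⁆∣ : ∀ {n} (p : Subset n) {a b} → a ≢ b →
              ∣ p ∩ (⁅ a ⁆ ∪ ⁅ b ⁆) ∣ ≡ indicator (lookup p a) + indicator (lookup p b)
∣p∩⁅a⁆∪⁅b⁆∣ p {a} {b} a≢b = begin
  ∣ p ∩ (⁅ a ⁆ ∪ ⁅ b ⁆) ∣  ≡⟨ ∣p∣≡∑indicator (p ∩ (⁅ a ⁆ ∪ ⁅ b ⁆)) ⟩
  ∑ f                     ≡⟨ ∑-supported-at-pair f a≢b f≡0 ⟩
  f a + f b               ≡⟨ cong₂ _+_ f-at-a f-at-b ⟩
  indicator (lookup p a) + indicator (lookup p b) ∎
  where
  f = indicator ∘ lookup (p ∩ (⁅ a ⁆ ∪ ⁅ b ⁆))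
  f≡0 : ∀ x → x ≢ a → x ≢ b → f x ≡ 0
  f≡0 x x≢a x≢b rewrite lookup-∩⁅a⁆∪⁅b⁆ p a b x | dec-false (x ≟ a) x≢a | dec-false (x ≟ b) x≢b
    = cong indicator (∧-zeroʳ (lookup p x))
  f-at-a : f a ≡ indicator (lookup p a)
  f-at-a rewrite lookup-∩⁅a⁆∪⁅b⁆ p a b a | dec-true (a ≟ a) refl
    = cong indicator (∧-identityʳ (lookup p a))
  f-at-b : f b ≡ indicator (lookup p b)
  f-at-b rewrite lookup-∩⁅a⁆∪⁅b⁆ p a b b | dec-true (b ≟ b) refl | ∨-zeroʳ (does (b ≟ a))
    = cong indicator (∧-identityʳ (lookup p b))

indicator-+≤1⇒∧≡false : ∀ b c → indicator b + indicator c ≤ 1 → b ∧ c ≡ false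
indicator-+≤1⇒∧≡false true  true  (s≤s ())
indicator-+≤1⇒∧≡false true  false _ = refl
indicator-+≤1⇒∧≡false false c     _ = refl

indicator-+≡0⊎2⇒≡ : ∀ b c → (indicator b + indicator c ≡ 0) ⊎ (indicator b + indicator c ≡ 2) → b ≡ c
indicator-+≡0⊎2⇒≡ true  true  _        = refl
indicator-+≡0⊎2⇒≡ false false _        = refl
indicator-+≡0⊎2⇒≡ true  false (inj₁ ())
indicator-+≡0⊎2⇒≡ true  false (inj₂ ())
indicator-+≡0⊎2⇒≡ false true  (inj₁ ())
indicator-+≡0⊎2⇒≡ false true  (inj₂ ())

indicator-+≡1⇒differences : ∀ b c → indicator b + indicator c ≡ 1 →
                            indicator (b ∧ not c) + indicator (c ∧ not b) ≡ 1
indicator-+≡1⇒differences true  true  ()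
indicator-+≡1⇒differences true  false _  = refl
indicator-+≡1⇒differences false true  _  = refl
indicator-+≡1⇒differences false false ()

T-injective : ∀ {b c} → (T b → T c) → (T c → T b) → b ≡ c
T-injective {false} {false} _   _   = refl
T-injective {false} {true}  _   c⇒b = ⊥-elim (c⇒b tt)
T-injective {true}  {false} b⇒c _   = ⊥-elim (b⇒c tt)
T-injective {true}  {true}  _   _   = refl

module _ {n} (_·_ : Fin n → Fin n → Fin n) (e : Fin n) where

  lookup-rightTranslate : ∀ {z} → Involutive _≡_ (_· z) → (S : Subset n) (x : Fin n) →
                          lookup (rightTranslate _·_ e S z) x ≡ lookup S (x · z)
  lookup-rightTranslate {z} ·z-involutive S x =
    trans (lookup∘tabulate _ x) (T-injective ⇒ ⇐)
    where
    maps-to-x : Fin n → Bool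
    maps-to-x s = lookup S s ∧ ⌊ (s · z) ≟ x ⌋
    ⇒ : T (any maps-to-x (allFin n)) → T (lookup S (x · z))
    ⇒ t with s , Ts ← satisfied (any⁻ maps-to-x (allFin n) t) with Ss , sz≡x ← Equivalence.to T-∧ Ts
      = subst (T ∘ lookup S) (trans (sym (·z-involutive s)) (cong (_· z) (toWitness sz≡x))) Ss
    ⇐ : T (lookup S (x · z)) → T (any maps-to-x (allFin n))
    ⇐ Sxz = any⁺ maps-to-x (lose (∈-allFin (x · z))
              (Equivalence.from T-∧ (Sxz , fromWitness (·z-involutive x))))

  product-indicator : Subset n → Fin n → Fin n → Fin n → ℕ
  product-indicator S a x y = indicator (lookup S x ∧ lookup S y ∧ ⌊ (x · y) ≟ a ⌋)

  reps≡∑∑ : ∀ S a → reps _·_ e S a ≡ ∑ λ x → ∑ (product-indicator S a x)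
  reps≡∑∑ S a = trans (sum-map-allFin (λ x → sum (map (product-indicator S a x) (allFin n))))
                      (sum-cong-≗ {n} λ x → sum-map-allFin (product-indicator S a x))

  reps-∘-involutive : ∀ {σ} → Involutive _≡_ σ → (∀ x y → σ x · σ y ≡ x · y) →
                      (S S′ : Subset n) → (∀ x → lookup S′ x ≡ lookup S (σ x)) →
                      ∀ a → reps _·_ e S′ a ≡ reps _·_ e S a
  reps-∘-involutive {σ} σ-involutive σ·σ S S′ S′≗S∘σ a = begin
    reps _·_ e S′ a
      ≡⟨ reps≡∑∑ S′ a ⟩
    ∑ (λ x → ∑ (product-indicator S′ a x))
      ≡⟨ sum-cong-≗ {n} (λ x → sum-cong-≗ {n} (translate x)) ⟩
    ∑ (λ x → ∑ (λ y → product-indicator S a (σ x) (σ y)))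
      ≡⟨ sum-cong-≗ {n} (λ x → ∑-∘-involutive (product-indicator S a (σ x)) σ-involutive) ⟩
    ∑ (λ x → ∑ (product-indicator S a (σ x)))
      ≡⟨ ∑-∘-involutive (λ x → ∑ (product-indicator S a x)) σ-involutive ⟩
    ∑ (λ x → ∑ (product-indicator S a x))
      ≡⟨ reps≡∑∑ S a ⟨
    reps _·_ e S a
      ∎
    where
    translate : ∀ x y → product-indicator S′ a x y ≡ product-indicator S a (σ x) (σ y)
    translate x y rewrite S′≗S∘σ x | S′≗S∘σ y | σ·σ x y = refl

module NormalSubgroupOfOrderTwo
  {n} {_·_ : Fin n → Fin n → Fin n} {e : Fin n} {_⁻¹ : Fin n → Fin n}
  (isGroup : IsGroup _≡_ _·_ e _⁻¹) {z : Fin n} (z≢e : z ≢ e) (z·z≡e : z · z ≡ e)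
  (normal : ∀ g → (g · z) · (g ⁻¹) ∈ subN _·_ e z) where

  private
    group : Group _ _
    group = record { isGroup = isGroup }

  open IsGroup isGroup using (assoc; identityˡ; identityʳ)
  open import Algebra.Properties.Group group using (identityʳ-unique; x∙y⁻¹≈ε⇒x≈y; //-rightDividesˡ)

  N : Subset n
  N = subN _·_ e z

  ∈N⇒≡e⊎≡z : ∀ {x} → x ∈ N → x ≡ e ⊎ x ≡ z
  ∈N⇒≡e⊎≡z = Sum.map (x∈⁅y⁆⇒x≡y e) (x∈⁅y⁆⇒x≡y z) ∘ x∈p∪q⁻ ⁅ e ⁆ ⁅ z ⁆

  ·z-involutive : Involutive _≡_ (_· z)
  ·z-involutive x = begin
    (x · z) · z  ≡⟨ assoc x z z ⟩
    x · (z · z)  ≡⟨ cong (x ·_) z·z≡e ⟩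
    x · e        ≡⟨ identityʳ x ⟩
    x            ∎

  ·z-fixedPointFree : ∀ g → g · z ≢ g
  ·z-fixedPointFree g = z≢e ∘ identityʳ-unique g z

  z-central : ∀ g → z · g ≡ g · z
  z-central g with ∈N⇒≡e⊎≡z (normal g)
  ... | inj₁ gzg⁻¹≡e = ⊥-elim (·z-fixedPointFree g (x∙y⁻¹≈ε⇒x≈y (g · z) g gzg⁻¹≡e))
  ... | inj₂ gzg⁻¹≡z = trans (cong (_· g) (sym gzg⁻¹≡z)) (//-rightDividesˡ g (g · z))

  ·z-·z : ∀ x y → (x · z) · (y · z) ≡ x · y
  ·z-·z x y = begin
    (x · z) · (y · z)  ≡⟨ assoc x z (y · z) ⟩
    x · (z · (y · z))  ≡⟨ cong (x ·_) (assoc z y z) ⟨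
    x · ((z · y) · z)  ≡⟨ cong (λ t → x · (t · z)) (z-central y) ⟩
    x · ((y · z) · z)  ≡⟨ cong (x ·_) (·z-involutive y) ⟩
    x · y              ∎

  ·z-Invariant : Subset n → Set
  ·z-Invariant T = ∀ x → lookup T (x · z) ≡ lookup T x

  ⁅a⁆∪⁅b⁆-·z-invariant : ∀ {a b} → a · z ≡ b → ·z-Invariant (⁅ a ⁆ ∪ ⁅ b ⁆)
  ⁅a⁆∪⁅b⁆-·z-invariant {a} {b} az≡b x = begin
    lookup (⁅ a ⁆ ∪ ⁅ b ⁆) (x · z)         ≡⟨ lookup-⁅a⁆∪⁅b⁆ a b (x · z) ⟩
    does (x · z ≟ a) ∨ does (x · z ≟ b)    ≡⟨ cong₂ _∨_ (·z-swap a b az≡b) (·z-swap b a bz≡a) ⟩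
    does (x ≟ b) ∨ does (x ≟ a)            ≡⟨ ∨-comm (does (x ≟ b)) (does (x ≟ a)) ⟩
    does (x ≟ a) ∨ does (x ≟ b)            ≡⟨ lookup-⁅a⁆∪⁅b⁆ a b x ⟨
    lookup (⁅ a ⁆ ∪ ⁅ b ⁆) x               ∎
    where
    bz≡a : b · z ≡ a
    bz≡a = trans (cong (_· z) (sym az≡b)) (·z-involutive a)
    ·z-swap : ∀ c d → c · z ≡ d → does (x · z ≟ c) ≡ does (x ≟ d)
    ·z-swap c d cz≡d = does-⇔ (mk⇔ to from) (x · z ≟ c) (x ≟ d)
      where
      to : x · z ≡ c → x ≡ d
      to xz≡c = trans (sym (·z-involutive x)) (trans (cong (_· z) xz≡c) cz≡d)
      from : x ≡ d → x · z ≡ c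
      from x≡d = trans (cong (_· z) (trans x≡d (sym cz≡d))) (·z-involutive c)

  N-·z-invariant : ·z-Invariant N
  N-·z-invariant = ⁅a⁆∪⁅b⁆-·z-invariant (identityˡ z)

  coset-·z-invariant : ∀ g → ·z-Invariant (cosetN _·_ e z g)
  coset-·z-invariant g = ⁅a⁆∪⁅b⁆-·z-invariant (cong (_· z) (identityʳ g))

  x≢e⇒x≢z⇒x∉N : ∀ {x} → x ≢ e → x ≢ z → x ∉ N
  x≢e⇒x≢z⇒x∉N x≢e x≢z = [ x≢e , x≢z ]′ ∘ ∈N⇒≡e⊎≡z

  module _ (S : Subset n) where

    Sz : Subset n
    Sz = rightTranslate _·_ e S z

    lookup-Sz : ∀ x → lookup Sz x ≡ lookup S (x · z)
    lookup-Sz = lookup-rightTranslate _·_ e ·z-involutive S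

    Sz-isSumSet : IsSumSet _·_ e S → IsSumSet _·_ e Sz
    Sz-isSumSet (μ , reps≡μ) = μ , λ a a≢e →
      trans (reps-∘-involutive _·_ e ·z-involutive ·z-·z S Sz lookup-Sz a) (reps≡μ a a≢e)

    ∣Sz∩T∣≡∣S∩T∣ : ∀ T → ·z-Invariant T → ∣ Sz ∩ T ∣ ≡ ∣ S ∩ T ∣
    ∣Sz∩T∣≡∣S∩T∣ T T-invariant = ∣∣-∘-involutive ·z-involutive (S ∩ T) (Sz ∩ T) λ x → begin
      lookup (Sz ∩ T) x                 ≡⟨ lookup-zipWith _∧_ x Sz T ⟩
      lookup Sz x ∧ lookup T x          ≡⟨ cong₂ _∧_ (lookup-Sz x) (sym (T-invariant x)) ⟩
      lookup S (x · z) ∧ lookup T (x · z) ≡⟨ lookup-zipWith _∧_ (x · z) S T ⟨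
      lookup (S ∩ T) (x · z)            ∎

    coset-counts-transfer : ∀ {P Q : ℕ → Set} →
      P ∣ S ∩ N ∣ × (∀ g → g ∉ N → Q ∣ S ∩ cosetN _·_ e z g ∣) →
      P ∣ Sz ∩ N ∣ × (∀ g → g ∉ N → Q ∣ Sz ∩ cosetN _·_ e z g ∣)
    coset-counts-transfer {P} {Q} (P-N , Q-cosets) =
        subst P (sym (∣Sz∩T∣≡∣S∩T∣ N N-·z-invariant)) P-N
      , λ g g∉N → subst Q (sym (∣Sz∩T∣≡∣S∩T∣ _ (coset-·z-invariant g))) (Q-cosets g g∉N)

    orbit-count : Fin n → ℕ
    orbit-count x = indicator (lookup S x) + indicator (lookup S (x · z))

    ∣S∩N∣≡orbit-count : ∀ {x} → x ∈ N → ∣ S ∩ N ∣ ≡ orbit-count x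
    ∣S∩N∣≡orbit-count x∈N with ∈N⇒≡e⊎≡z x∈N
    ... | inj₁ refl = trans (∣p∩⁅a⁆∪⁅b⁆∣ S (z≢e ∘ sym))
                            (cong (λ y → indicator (lookup S e) + indicator (lookup S y)) (sym (identityˡ z)))
    ... | inj₂ refl = trans (∣p∩⁅a⁆∪⁅b⁆∣ S (z≢e ∘ sym))
                            (trans (+-comm (indicator (lookup S e)) _)
                                   (cong (λ y → indicator (lookup S z) + indicator (lookup S y)) (sym z·z≡e)))

    ∣S∩gN∣≡orbit-count : ∀ g → ∣ S ∩ cosetN _·_ e z g ∣ ≡ orbit-count g
    ∣S∩gN∣≡orbit-count g = trans (∣p∩⁅a⁆∪⁅b⁆∣ S ge≢gz)
                                 (cong (λ y → indicator (lookup S y) + indicator (lookup S (g · z))) (identityʳ g))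
      where
      ge≢gz : g · e ≢ g · z
      ge≢gz ge≡gz = ·z-fixedPointFree g (trans (sym ge≡gz) (identityʳ g))

    type1-orbit-count≤1 : Type1 _·_ e z S → ∀ x → orbit-count x ≤ 1
    type1-orbit-count≤1 (∣S∩N∣≡0 , ∣S∩gN∣≤1) x with x ∈? N
    ... | yes x∈N = subst (_≤ 1) (trans (sym ∣S∩N∣≡0) (∣S∩N∣≡orbit-count x∈N)) z≤n
    ... | no  x∉N = subst (_≤ 1) (∣S∩gN∣≡orbit-count x) (∣S∩gN∣≤1 x x∉N)

    type1-Sz∩S-empty : Type1 _·_ e z S → Empty (Sz ∩ S)
    type1-Sz∩S-empty type1 (x , x∈Sz∩S) = contradiction (begin
      true                           ≡⟨ []=⇒lookup x∈Sz∩S ⟨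
      lookup (Sz ∩ S) x              ≡⟨ lookup-zipWith _∧_ x Sz S ⟩
      lookup Sz x ∧ lookup S x       ≡⟨ cong (_∧ lookup S x) (lookup-Sz x) ⟩
      lookup S (x · z) ∧ lookup S x  ≡⟨ ∧-comm (lookup S (x · z)) (lookup S x) ⟩
      lookup S x ∧ lookup S (x · z)  ≡⟨ indicator-+≤1⇒∧≡false (lookup S x) (lookup S (x · z))
                                                                (type1-orbit-count≤1 type1 x) ⟩
      false                          ∎) λ ()

    type2-orbit-constant : Type2 _·_ e z S → ∀ x → x ∉ N → lookup S x ≡ lookup S (x · z)
    type2-orbit-constant (_ , ∣S∩gN∣≡0⊎2) x x∉N = indicator-+≡0⊎2⇒≡ (lookup S x) (lookup S (x · z))
      (subst (λ k → k ≡ 0 ⊎ k ≡ 2) (∣S∩gN∣≡orbit-count x) (∣S∩gN∣≡0⊎2 x x∉N))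

    lookup-S─Sz : ∀ x → lookup (S ─ Sz) x ≡ lookup S x ∧ not (lookup S (x · z))
    lookup-S─Sz x = trans (lookup-─ S Sz x) (cong (λ b → lookup S x ∧ not b) (lookup-Sz x))

    type2-∣S─Sz∣≡1 : Type2 _·_ e z S → ∣ S ─ Sz ∣ ≡ 1
    type2-∣S─Sz∣≡1 type2@(∣S∩N∣≡1 , _) = begin
      ∣ S ─ Sz ∣  ≡⟨ ∣p∣≡∑indicator (S ─ Sz) ⟩
      ∑ f        ≡⟨ ∑-supported-at-pair f (z≢e ∘ sym) f≡0 ⟩
      f e + f z  ≡⟨ cong₂ _+_ f-at-e f-at-z ⟩
      indicator (lookup S e ∧ not (lookup S z)) + indicator (lookup S z ∧ not (lookup S e))
                 ≡⟨ indicator-+≡1⇒differences (lookup S e) (lookup S z)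
                   (trans (sym (∣p∩⁅a⁆∪⁅b⁆∣ S (z≢e ∘ sym))) ∣S∩N∣≡1) ⟩
      1          ∎
      where
      f : Fin n → ℕ
      f = indicator ∘ lookup (S ─ Sz)
      f-at-e : f e ≡ indicator (lookup S e ∧ not (lookup S z))
      f-at-e = cong indicator (trans (lookup-S─Sz e) (cong (λ y → lookup S e ∧ not (lookup S y)) (identityˡ z)))
      f-at-z : f z ≡ indicator (lookup S z ∧ not (lookup S e))
      f-at-z = cong indicator (trans (lookup-S─Sz z) (cong (λ y → lookup S z ∧ not (lookup S y)) z·z≡e))
      f≡0 : ∀ x → x ≢ e → x ≢ z → f x ≡ 0
      f≡0 x x≢e x≢z = cong indicator (begin
        lookup (S ─ Sz) x                     ≡⟨ lookup-S─Sz x ⟩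
        lookup S x ∧ not (lookup S (x · z))   ≡⟨ cong (_∧ not (lookup S (x · z)))
                                                      (type2-orbit-constant type2 x (x≢e⇒x≢z⇒x∉N x≢e x≢z)) ⟩
        lookup S (x · z) ∧ not (lookup S (x · z)) ≡⟨ ∧-inverseʳ (lookup S (x · z)) ⟩
        false                                 ∎)

    ∣Sz─S∣≡∣S─Sz∣ : ∣ Sz ─ S ∣ ≡ ∣ S ─ Sz ∣
    ∣Sz─S∣≡∣S─Sz∣ = ∣∣-∘-involutive ·z-involutive (S ─ Sz) (Sz ─ S) λ x → begin
      lookup (Sz ─ S) x                                ≡⟨ lookup-─ Sz S x ⟩
      lookup Sz x ∧ not (lookup S x)                   ≡⟨ cong₂ (λ b c → b ∧ not c) (lookup-Sz x)
                                                                (cong (lookup S) (sym (·z-involutive x))) ⟩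
      lookup S (x · z) ∧ not (lookup S ((x · z) · z))  ≡⟨ lookup-S─Sz (x · z) ⟨
      lookup (S ─ Sz) (x · z)                          ∎

lemma5p2 : (n : ℕ) (_·_ : Fin n → Fin n → Fin n) (e : Fin n) (_⁻¹ : Fin n → Fin n) →
    IsGroup _≡_ _·_ e _⁻¹ →
    (z : Fin n) → ¬ (z ≡ e) → (z · z) ≡ e →
    (∀ g → ((g · z) · (g ⁻¹)) ∈ subN _·_ e z) →
    (S : Subset n) → IsSumSet _·_ e S →
    (Type1 _·_ e z S →
       IsSumSet _·_ e (rightTranslate _·_ e S z) × Type1 _·_ e z (rightTranslate _·_ e S z)
       × Empty (rightTranslate _·_ e S z ∩ S))
    × (Type2 _·_ e z S →
       IsSumSet _·_ e (rightTranslate _·_ e S z) × Type2 _·_ e z (rightTranslate _·_ e S z)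
       × (∣ S ─ rightTranslate _·_ e S z ∣ ≡ 1) × (∣ rightTranslate _·_ e S z ─ S ∣ ≡ 1))
lemma5p2 n _·_ e _⁻¹ isGroup z z≢e z·z≡e normal S S-isSumSet =
    (λ type1 → Sz-isSumSet S S-isSumSet , coset-counts-transfer S {_≡ 0} {_≤ 1} type1
             , type1-Sz∩S-empty S type1)
  , (λ type2 → Sz-isSumSet S S-isSumSet , coset-counts-transfer S {_≡ 1} {λ k → k ≡ 0 ⊎ k ≡ 2} type2
             , type2-∣S─Sz∣≡1 S type2 , trans (∣Sz─S∣≡∣S─Sz∣ S) (type2-∣S─Sz∣≡1 S type2))
  where open NormalSubgroupOfOrderTwo isGroup z≢e z·z≡e normal
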